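{- Let $K$ be a field of characteristic zero, let $A,B$ be nonzero rational numbers, let $0\le k\le 5$ be an integer and let $m$ be a positive integer dividing $\gcd(6,k)$. Let $E_{A,B}/K(t)$ be the elliptic curve $y^2=x^3+At^6+B$ and $E_{A,B,k,m}/K(s)$ the elliptic curve $y^2=x^3+s^k(As^m+B)$. Put $q=6/m$ and $r=k/m$. Then the map \[(f(s),g(s))\mapsto\left(\frac{f(t^q)}{t^{2r}},\frac{g(t^q)}{t^{3r}}\right)\] (sending the point at infinity to the point at infinity) defines an injective group homomorphism $E_{A,B,k,m}(K(s))\to E_{A,B}(K(t))$; thus $E_{A,B,k,m}(K(s))$ is (identified with) a subgroup of $E_{A,B}(K(t))$. -}

module Defs where

open import Level using (Level; _⊔_; suc)
open import Algebra.Bundles using (CommutativeRing)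
open import Data.Nat as ℕ using (ℕ; zero)
open import Data.Integer as ℤ using (ℤ; +_; -[1+_])
open import Data.Rational as ℚ using (ℚ)
open import Data.List using (List; []; _∷_; map; replicate; _++_)
open import Data.List.Relation.Unary.All using (All)
open import Data.Product using (Σ; _×_)
open import Data.Sum using (_⊎_)
open import Data.Unit.Polymorphic using (⊤)
open import Data.Empty.Polymorphic using (⊥)
open import Relation.Nullary using (¬_)

record Field (c ℓ : Level) : Set (suc (c ⊔ ℓ)) where
  field
    commutativeRing : CommutativeRing c ℓ
  open CommutativeRing commutativeRing public
  field
    0≉1     : ¬ (0# ≈ 1#)
    inverse : ∀ x → ¬ (x ≈ 0#) → Σ Carrier (λ y → (x * y) ≈ 1#)

module _ {c ℓ : Level} (F : Field c ℓ) where
  open Field F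

  ℕ→F : ℕ → Carrier
  ℕ→F zero      = 0#
  ℕ→F (ℕ.suc n) = 1# + ℕ→F n

  ℤ→F : ℤ → Carrier
  ℤ→F (+ n)      = ℕ→F n
  ℤ→F -[1+ n ]   = - ℕ→F (ℕ.suc n)

  CharZero : Set ℓ
  CharZero = ∀ n → ¬ (ℕ→F (ℕ.suc n) ≈ 0#)

  -- Polynomials F[X]: coefficient lists, lowest degree first.

  Poly : Set c
  Poly = List Carrier

  IsZeroP : Poly → Set (c ⊔ ℓ)
  IsZeroP p = All (λ a → a ≈ 0#) p

  _+P_ : Poly → Poly → Poly
  []      +P q       = q
  (a ∷ p) +P []      = a ∷ p
  (a ∷ p) +P (b ∷ q) = (a + b) ∷ (p +P q)

  -P_ : Poly → Poly
  -P p = map -_ p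

  _*P_ : Poly → Poly → Poly
  []      *P q = []
  (a ∷ p) *P q = map (a *_) q +P (0# ∷ (p *P q))

  _≈P_ : Poly → Poly → Set (c ⊔ ℓ)
  p ≈P q = IsZeroP (p +P (-P q))

  constP : Carrier → Poly
  constP a = a ∷ []

  X^ : ℕ → Poly
  X^ n = replicate n 0# ++ (1# ∷ [])

  _∘P_ : Poly → Poly → Poly
  []      ∘P g = []
  (a ∷ p) ∘P g = constP a +P (g *P (p ∘P g))

  -- Rational function field F(X): fractions num/den, with the usual
  -- equality n₁/d₁ = n₂/d₂ iff n₁d₂ = n₂d₁; a fraction is an element of
  -- F(X) when its denominator is a nonzero polynomial ('ValidR').

  record RatF : Set c where
    constructor _/R_
    field
      num : Poly
      den : Poly
  open RatF public

  ValidR : RatF → Set (c ⊔ ℓ)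
  ValidR f = ¬ IsZeroP (den f)

  _≈R_ : RatF → RatF → Set (c ⊔ ℓ)
  f ≈R g = (num f *P den g) ≈P (num g *P den f)

  _+R_ : RatF → RatF → RatF
  f +R g = ((num f *P den g) +P (num g *P den f)) /R (den f *P den g)

  _*R_ : RatF → RatF → RatF
  f *R g = (num f *P num g) /R (den f *P den g)

  -R_ : RatF → RatF
  -R f = (-P num f) /R den f

  _-R_ : RatF → RatF → RatF
  f -R g = f +R (-R g)

  polyR : Poly → RatF
  polyR p = p /R constP 1#

  ℕ→R : ℕ → RatF
  ℕ→R n = polyR (constP (ℕ→F n))

  ℚ→R : ℚ → RatF
  ℚ→R x = constP (ℤ→F (ℚ.numerator x)) /R constP (ℕ→F (ℚ.denominatorℕ x))

  XR^ : ℕ → RatF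
  XR^ n = polyR (X^ n)

  data Pt : Set c where
    O  : Pt
    pt : RatF → RatF → Pt

  OnCurve : RatF → Pt → Set (c ⊔ ℓ)
  OnCurve D O        = ⊤
  OnCurve D (pt x y) =
    ValidR x × ValidR y × ((y *R y) ≈R (((x *R x) *R x) +R D))

  _≈Pt_ : Pt → Pt → Set (c ⊔ ℓ)
  O        ≈Pt O          = ⊤
  O        ≈Pt pt _ _     = ⊥
  pt _ _   ≈Pt O          = ⊥
  pt x y   ≈Pt pt x′ y′   = (x ≈R x′) × (y ≈R y′)

  -- IsSum P Q R :  "P + Q = R" in the group E(F(X)) of y² = x³ + D.
  -- λ is characterised by its defining equation (it is the slope).
  IsSum : Pt → Pt → Pt → Set (c ⊔ ℓ)
  IsSum O Q R = R ≈Pt Q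
  IsSum (pt x₁ y₁) O R = R ≈Pt pt x₁ y₁
  IsSum (pt x₁ y₁) (pt x₂ y₂) R =
      ( ¬ (x₁ ≈R x₂)
      × Σ RatF (λ l → ValidR l × ((l *R (x₂ -R x₁)) ≈R (y₂ -R y₁))
          × R ≈Pt pt (((l *R l) -R x₁) -R x₂)
                     ((l *R (x₁ -R (((l *R l) -R x₁) -R x₂))) -R y₁)))
    ⊎
      ( (x₁ ≈R x₂) × (y₁ ≈R (-R y₂)) × (R ≈Pt O) )
    ⊎
      ( (x₁ ≈R x₂) × (y₁ ≈R y₂) × ¬ (y₁ ≈R ℕ→R 0)
      × Σ RatF (λ l → ValidR l
          × ((l *R (ℕ→R 2 *R y₁)) ≈R (ℕ→R 3 *R (x₁ *R x₁)))
          × R ≈Pt pt ((l *R l) -R (ℕ→R 2 *R x₁))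
                     ((l *R (x₁ -R ((l *R l) -R (ℕ→R 2 *R x₁)))) -R y₁)))

  -- The curves of the theorem (the variable is X: written t resp. s).

  D-AB : ℚ → ℚ → RatF
  D-AB A B = (ℚ→R A *R XR^ 6) +R ℚ→R B

  D-ABkm : ℚ → ℚ → ℕ → ℕ → RatF
  D-ABkm A B k m = XR^ k *R ((ℚ→R A *R XR^ m) +R ℚ→R B)

  subR : ℕ → RatF → RatF
  subR q f = (num f ∘P X^ q) /R (den f ∘P X^ q)

  φ : ℕ → ℕ → Pt → Pt
  φ q r O        = O
  φ q r (pt f g) =
    pt (num (subR q f) /R (den (subR q f) *P X^ (2 ℕ.* r)))
       (num (subR q g) /R (den (subR q g) *P X^ (3 ℕ.* r)))

{-# OPTIONS --safe #-}
-- Substituting t^q for s is an injective ring homomorphism ψ : K[s] → K[t].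
-- Give x, y and the slope λ of the group law the weights 2r, 3r and r, and
-- send a rational function f of weight w to ψ(f)/t^w.  Every equation in the
-- definition of the curve and of its group law is homogeneous for these
-- weights, and since q m = 6 and q k = 6 r the coefficient s^k (A s^m + B),
-- of weight 6r, goes to A t^6 + B.  Hence each such equation over K(s) is
-- carried to the corresponding one over K(t), and injectivity of ψ carries
-- equalities, hence also disequalities, back.  Fractions are compared by
-- cross-multiplication, and intermediate expressions are rewritten only up
-- to common factors of numerator and denominator that are powers of t; these
-- can be cancelled in K[t] without deciding equality in K.
module Submission where

open import Defs
open import Level using (Level; _⊔_)
open import Data.Nat as ℕ using (ℕ; zero; suc; _≤_; _/_; NonZero)
open import Data.Nat.Divisibility using (_∣_; ∣-trans)
open import Data.Nat.DivMod using (m/n*n≡m; m*[n/m]≡n)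
open import Data.Nat.GCD using (gcd; gcd[m,n]∣m; gcd[m,n]∣n)
import Data.Nat.Properties as ℕ
open import Data.Rational using (ℚ; 0ℚ)
open import Data.Product using (_×_; _,_)
open import Data.Sum using (inj₁; inj₂)
open import Data.Unit.Polymorphic using (tt)
open import Data.List using ([]; _∷_; map)
open import Data.List.Relation.Unary.All using ([]; _∷_)
open import Algebra.Bundles using (CommutativeRing)
open import Algebra.Structures using (IsCommutativeRing)
open import Relation.Binary.Structures using (IsEquivalence)
open import Relation.Binary.PropositionalEquality using (_≢_)
import Relation.Binary.PropositionalEquality as ≡
open ≡ using (_≡_)

module Cancellation {c ℓ : Level} (R : CommutativeRing c ℓ) where
  open CommutativeRing R
  open import Algebra.Properties.Ring ring using (-‿distribˡ-*)
  open import Algebra.Properties.AbelianGroup +-abelianGroup using (x∙y⁻¹≈ε⇒x≈y; x≈y⇒x∙y⁻¹≈ε)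
  open import Relation.Binary.Reasoning.Setoid setoid

  Cancellable : Carrier → Set (c ⊔ ℓ)
  Cancellable v = ∀ x y → x * v ≈ y * v → x ≈ y

  1#-cancellable : Cancellable 1#
  1#-cancellable x y x1≈y1 = trans (sym (*-identityʳ x)) (trans x1≈y1 (*-identityʳ y))

  *-cancellable : ∀ {v w} → Cancellable v → Cancellable w → Cancellable (v * w)
  *-cancellable {v} {w} cancel-v cancel-w x y xvw≈yvw = cancel-v x y (cancel-w (x * v) (y * v)
    (trans (*-assoc x v w) (trans xvw≈yvw (sym (*-assoc y v w)))))

  annihilatorFree⇒cancellable : ∀ {v} → (∀ x → x * v ≈ 0# → x ≈ 0#) → Cancellable v
  annihilatorFree⇒cancellable {v} annihilatorFree x y xv≈yv =
    x∙y⁻¹≈ε⇒x≈y x y (annihilatorFree (x - y) (begin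
      (x - y) * v        ≈⟨ distribʳ v x (- y) ⟩
      x * v + (- y) * v  ≈⟨ +-congˡ (-‿distribˡ-* y v) ⟨
      x * v - y * v      ≈⟨ x≈y⇒x∙y⁻¹≈ε xv≈yv ⟩
      0#                 ∎))

module ScaledEquations {c ℓ : Level} (R : CommutativeRing c ℓ) where
  open CommutativeRing R
  open import Algebra.Properties.CommutativeSemigroup *-commutativeSemigroup
    using (interchange; xy∙z≈xz∙y)
  open import Algebra.Properties.Ring ring using (-‿distribˡ-*)
  open import Relation.Binary.Reasoning.Setoid setoid

  scaled-trans : ∀ x y z {s s′ t t′} →
    x * s ≈ y * s′ → y * t ≈ z * t′ → x * (s * t) ≈ z * (t′ * s′)
  scaled-trans x y z {s} {s′} {t} {t′} xs≈ys′ yt≈zt′ = begin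
    x * (s * t)    ≈⟨ *-assoc x s t ⟨
    (x * s) * t    ≈⟨ *-congʳ xs≈ys′ ⟩
    (y * s′) * t   ≈⟨ xy∙z≈xz∙y y s′ t ⟩
    (y * t) * s′   ≈⟨ *-congʳ yt≈zt′ ⟩
    (z * t′) * s′  ≈⟨ *-assoc z t′ s′ ⟩
    z * (t′ * s′)  ∎

  scaled-* : ∀ x x′ y y′ {s s′ t t′} → x * s ≈ x′ * s′ → y * t ≈ y′ * t′ →
    (x * y) * (s * t) ≈ (x′ * y′) * (s′ * t′)
  scaled-* x x′ y y′ {s} {s′} {t} {t′} xs≈x′s′ yt≈y′t′ = begin
    (x * y) * (s * t)      ≈⟨ interchange x y s t ⟩
    (x * s) * (y * t)      ≈⟨ *-cong xs≈x′s′ yt≈y′t′ ⟩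
    (x′ * s′) * (y′ * t′)  ≈⟨ interchange x′ s′ y′ t′ ⟩
    (x′ * y′) * (s′ * t′)  ∎

  scaled-+ : ∀ x x′ y y′ z z′ w w′ {s s′ t t′} →
    x * s ≈ x′ * s′ → y * s ≈ y′ * s′ → z * t ≈ z′ * t′ → w * t ≈ w′ * t′ →
    (x * w + z * y) * (s * t) ≈ (x′ * w′ + z′ * y′) * (s′ * t′)
  scaled-+ x x′ y y′ z z′ w w′ {s} {s′} {t} {t′} xs≈ ys≈ zt≈ wt≈ = begin
    (x * w + z * y) * (s * t)
      ≈⟨ distribʳ (s * t) (x * w) (z * y) ⟩
    (x * w) * (s * t) + (z * y) * (s * t)
      ≈⟨ +-congˡ (*-congˡ (*-comm s t)) ⟩
    (x * w) * (s * t) + (z * y) * (t * s)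
      ≈⟨ +-cong (scaled-* x x′ w w′ xs≈ wt≈) (scaled-* z z′ y y′ zt≈ ys≈) ⟩
    (x′ * w′) * (s′ * t′) + (z′ * y′) * (t′ * s′)
      ≈⟨ +-congˡ (*-congˡ (*-comm t′ s′)) ⟩
    (x′ * w′) * (s′ * t′) + (z′ * y′) * (s′ * t′)
      ≈⟨ distribʳ (s′ * t′) (x′ * w′) (z′ * y′) ⟨
    (x′ * w′ + z′ * y′) * (s′ * t′)
      ∎

  scaled-neg : ∀ x x′ {s s′} → x * s ≈ x′ * s′ → (- x) * s ≈ (- x′) * s′
  scaled-neg x x′ {s} {s′} xs≈x′s′ = begin
    (- x) * s     ≈⟨ -‿distribˡ-* x s ⟨
    - (x * s)     ≈⟨ -‿cong xs≈x′s′ ⟩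
    - (x′ * s′)   ≈⟨ -‿distribˡ-* x′ s′ ⟩
    (- x′) * s′   ∎

module PolynomialRing {c ℓ : Level} (K : Field c ℓ) where
  open CommutativeRing (Field.commutativeRing K) hiding (zero)
  open import Algebra.Properties.CommutativeSemigroup +-commutativeSemigroup
    using () renaming (interchange to +-interchange)
  open import Algebra.Properties.Ring ring using (-0#≈0#)
  open import Relation.Binary.Reasoning.Setoid setoid

  Pol : Set c
  Pol = Poly K

  infixl 6 _+ₚ_
  infixl 7 _*ₚ_
  infix  8 -ₚ_
  infix  4 _≋_

  _+ₚ_ : Pol → Pol → Pol
  _+ₚ_ = _+P_ K

  _*ₚ_ : Pol → Pol → Pol
  _*ₚ_ = _*P_ K

  -ₚ_ : Pol → Pol
  -ₚ_ = -P_ K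

  1ₚ : Pol
  1ₚ = 1# ∷ []

  scale : Carrier → Pol → Pol
  scale a = map (a *_)

  coeff : ℕ → Pol → Carrier
  coeff _       []      = 0#
  coeff zero    (a ∷ _) = a
  coeff (suc i) (_ ∷ p) = coeff i p

  record _≋_ (p q : Pol) : Set ℓ where
    constructor mk≋
    field coeff-≈ : ∀ i → coeff i p ≈ coeff i q
  open _≋_ public

  ≋-refl : ∀ {p} → p ≋ p
  ≋-refl = mk≋ λ _ → refl

  ≋-sym : ∀ {p q} → p ≋ q → q ≋ p
  ≋-sym p≋q = mk≋ λ i → sym (coeff-≈ p≋q i)

  ≋-trans : ∀ {p q r} → p ≋ q → q ≋ r → p ≋ r
  ≋-trans p≋q q≋r = mk≋ λ i → trans (coeff-≈ p≋q i) (coeff-≈ q≋r i)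

  ≋-isEquivalence : IsEquivalence _≋_
  ≋-isEquivalence = record { refl = ≋-refl ; sym = ≋-sym ; trans = ≋-trans }

  ∷-cong : ∀ {a b p q} → a ≈ b → p ≋ q → a ∷ p ≋ b ∷ q
  ∷-cong a≈b p≋q = mk≋ λ { zero → a≈b ; (suc i) → coeff-≈ p≋q i }

  ∷-≋-[] : ∀ {a p} → a ≈ 0# → p ≋ [] → a ∷ p ≋ []
  ∷-≋-[] a≈0 p≋[] = mk≋ λ { zero → a≈0 ; (suc i) → coeff-≈ p≋[] i }

  ∷-≋-[]⁻ʰ : ∀ {a p} → a ∷ p ≋ [] → a ≈ 0#
  ∷-≋-[]⁻ʰ a∷p≋[] = coeff-≈ a∷p≋[] 0

  ∷-≋-[]⁻ᵗ : ∀ {a p} → a ∷ p ≋ [] → p ≋ []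
  ∷-≋-[]⁻ᵗ a∷p≋[] = mk≋ λ i → coeff-≈ a∷p≋[] (suc i)

  ∷-≋-∷⁻ᵗ : ∀ {a b p q} → a ∷ p ≋ b ∷ q → p ≋ q
  ∷-≋-∷⁻ᵗ a∷p≋b∷q = mk≋ λ i → coeff-≈ a∷p≋b∷q (suc i)

  coeff-+ : ∀ i p q → coeff i (p +ₚ q) ≈ coeff i p + coeff i q
  coeff-+ _       []      _       = sym (+-identityˡ _)
  coeff-+ _       (_ ∷ _) []      = sym (+-identityʳ _)
  coeff-+ zero    (_ ∷ _) (_ ∷ _) = refl
  coeff-+ (suc i) (_ ∷ p) (_ ∷ q) = coeff-+ i p q

  coeff-neg : ∀ i p → coeff i (-ₚ p) ≈ - coeff i p
  coeff-neg _       []      = sym -0#≈0#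
  coeff-neg zero    (_ ∷ _) = refl
  coeff-neg (suc i) (_ ∷ p) = coeff-neg i p

  coeff-scale : ∀ i a p → coeff i (scale a p) ≈ a * coeff i p
  coeff-scale _       a []      = sym (zeroʳ a)
  coeff-scale zero    _ (_ ∷ _) = refl
  coeff-scale (suc i) a (_ ∷ p) = coeff-scale i a p

  +ₚ-cong : ∀ {p p′ q q′} → p ≋ p′ → q ≋ q′ → p +ₚ q ≋ p′ +ₚ q′
  +ₚ-cong {p} {p′} {q} {q′} p≋p′ q≋q′ = mk≋ λ i → begin
    coeff i (p +ₚ q)          ≈⟨ coeff-+ i p q ⟩
    coeff i p + coeff i q     ≈⟨ +-cong (coeff-≈ p≋p′ i) (coeff-≈ q≋q′ i) ⟩
    coeff i p′ + coeff i q′   ≈⟨ coeff-+ i p′ q′ ⟨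
    coeff i (p′ +ₚ q′)        ∎

  +ₚ-assoc : ∀ p q r → (p +ₚ q) +ₚ r ≋ p +ₚ (q +ₚ r)
  +ₚ-assoc p q r = mk≋ λ i → begin
    coeff i ((p +ₚ q) +ₚ r)                ≈⟨ coeff-+ i (p +ₚ q) r ⟩
    coeff i (p +ₚ q) + coeff i r           ≈⟨ +-congʳ (coeff-+ i p q) ⟩
    (coeff i p + coeff i q) + coeff i r    ≈⟨ +-assoc _ _ _ ⟩
    coeff i p + (coeff i q + coeff i r)    ≈⟨ +-congˡ (coeff-+ i q r) ⟨
    coeff i p + coeff i (q +ₚ r)           ≈⟨ coeff-+ i p (q +ₚ r) ⟨
    coeff i (p +ₚ (q +ₚ r))                ∎

  +ₚ-comm : ∀ p q → p +ₚ q ≋ q +ₚ p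
  +ₚ-comm p q = mk≋ λ i → begin
    coeff i (p +ₚ q)        ≈⟨ coeff-+ i p q ⟩
    coeff i p + coeff i q   ≈⟨ +-comm _ _ ⟩
    coeff i q + coeff i p   ≈⟨ coeff-+ i q p ⟨
    coeff i (q +ₚ p)        ∎

  +ₚ-interchange : ∀ p q r s → (p +ₚ q) +ₚ (r +ₚ s) ≋ (p +ₚ r) +ₚ (q +ₚ s)
  +ₚ-interchange p q r s = mk≋ λ i → begin
    coeff i ((p +ₚ q) +ₚ (r +ₚ s))
      ≈⟨ trans (coeff-+ i (p +ₚ q) (r +ₚ s)) (+-cong (coeff-+ i p q) (coeff-+ i r s)) ⟩
    (coeff i p + coeff i q) + (coeff i r + coeff i s)
      ≈⟨ +-interchange _ _ _ _ ⟩
    (coeff i p + coeff i r) + (coeff i q + coeff i s)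
      ≈⟨ trans (coeff-+ i (p +ₚ r) (q +ₚ s)) (+-cong (coeff-+ i p r) (coeff-+ i q s)) ⟨
    coeff i ((p +ₚ r) +ₚ (q +ₚ s))
      ∎

  +ₚ-identityʳ : ∀ p → p +ₚ [] ≋ p
  +ₚ-identityʳ p = mk≋ λ i → trans (coeff-+ i p []) (+-identityʳ _)

  -ₚ-cong : ∀ {p q} → p ≋ q → -ₚ p ≋ -ₚ q
  -ₚ-cong {p} {q} p≋q = mk≋ λ i →
    trans (coeff-neg i p) (trans (-‿cong (coeff-≈ p≋q i)) (sym (coeff-neg i q)))

  -ₚ-inverseˡ : ∀ p → -ₚ p +ₚ p ≋ []
  -ₚ-inverseˡ p = mk≋ λ i →
    trans (coeff-+ i (-ₚ p) p) (trans (+-congʳ (coeff-neg i p)) (-‿inverseˡ _))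

  -ₚ-inverseʳ : ∀ p → p +ₚ -ₚ p ≋ []
  -ₚ-inverseʳ p = mk≋ λ i →
    trans (coeff-+ i p (-ₚ p)) (trans (+-congˡ (coeff-neg i p)) (-‿inverseʳ _))

  scale-cong : ∀ {a b p q} → a ≈ b → p ≋ q → scale a p ≋ scale b q
  scale-cong {a} {b} {p} {q} a≈b p≋q = mk≋ λ i →
    trans (coeff-scale i a p) (trans (*-cong a≈b (coeff-≈ p≋q i)) (sym (coeff-scale i b q)))

  scale-distribˡ : ∀ a p q → scale a (p +ₚ q) ≋ scale a p +ₚ scale a q
  scale-distribˡ a p q = mk≋ λ i → begin
    coeff i (scale a (p +ₚ q))                 ≈⟨ coeff-scale i a (p +ₚ q) ⟩
    a * coeff i (p +ₚ q)                       ≈⟨ *-congˡ (coeff-+ i p q) ⟩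
    a * (coeff i p + coeff i q)                ≈⟨ distribˡ _ _ _ ⟩
    a * coeff i p + a * coeff i q              ≈⟨ +-cong (coeff-scale i a p) (coeff-scale i a q) ⟨
    coeff i (scale a p) + coeff i (scale a q)  ≈⟨ coeff-+ i (scale a p) (scale a q) ⟨
    coeff i (scale a p +ₚ scale a q)           ∎

  scale-distribʳ : ∀ a b p → scale (a + b) p ≋ scale a p +ₚ scale b p
  scale-distribʳ a b p = mk≋ λ i → begin
    coeff i (scale (a + b) p)                  ≈⟨ coeff-scale i (a + b) p ⟩
    (a + b) * coeff i p                        ≈⟨ distribʳ _ _ _ ⟩
    a * coeff i p + b * coeff i p              ≈⟨ +-cong (coeff-scale i a p) (coeff-scale i b p) ⟨
    coeff i (scale a p) + coeff i (scale b p)  ≈⟨ coeff-+ i (scale a p) (scale b p) ⟨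
    coeff i (scale a p +ₚ scale b p)           ∎

  scale-assoc : ∀ a b p → scale a (scale b p) ≋ scale (a * b) p
  scale-assoc a b p = mk≋ λ i → begin
    coeff i (scale a (scale b p))  ≈⟨ coeff-scale i a (scale b p) ⟩
    a * coeff i (scale b p)        ≈⟨ *-congˡ (coeff-scale i b p) ⟩
    a * (b * coeff i p)            ≈⟨ *-assoc _ _ _ ⟨
    (a * b) * coeff i p            ≈⟨ coeff-scale i (a * b) p ⟨
    coeff i (scale (a * b) p)      ∎

  scale-identity : ∀ p → scale 1# p ≋ p
  scale-identity p = mk≋ λ i → trans (coeff-scale i 1# p) (*-identityˡ _)

  scale-zero : ∀ p → scale 0# p ≋ []
  scale-zero p = mk≋ λ i → trans (coeff-scale i 0# p) (zeroˡ _)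

  0∷-+ₚ : ∀ p q → 0# ∷ (p +ₚ q) ≋ (0# ∷ p) +ₚ (0# ∷ q)
  0∷-+ₚ _ _ = ∷-cong (sym (+-identityʳ 0#)) ≋-refl

  *ₚ-zeroˡ : ∀ {p} q → p ≋ [] → p *ₚ q ≋ []
  *ₚ-zeroˡ {[]}    q _     = ≋-refl
  *ₚ-zeroˡ {a ∷ p} q a∷p≋[] = +ₚ-cong
    (≋-trans (scale-cong (∷-≋-[]⁻ʰ a∷p≋[]) ≋-refl) (scale-zero q))
    (∷-≋-[] refl (*ₚ-zeroˡ q (∷-≋-[]⁻ᵗ a∷p≋[])))

  *ₚ-congˡ : ∀ {p p′} q → p ≋ p′ → p *ₚ q ≋ p′ *ₚ q
  *ₚ-congˡ {[]}    {_}      q p≋p′ = ≋-sym (*ₚ-zeroˡ q (≋-sym p≋p′))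
  *ₚ-congˡ {_ ∷ _} {[]}     q p≋p′ = *ₚ-zeroˡ q p≋p′
  *ₚ-congˡ {_ ∷ _} {_ ∷ _}  q p≋p′ =
    +ₚ-cong (scale-cong (coeff-≈ p≋p′ 0) ≋-refl) (∷-cong refl (*ₚ-congˡ q (∷-≋-∷⁻ᵗ p≋p′)))

  *ₚ-congʳ : ∀ p {q q′} → q ≋ q′ → p *ₚ q ≋ p *ₚ q′
  *ₚ-congʳ []      _    = ≋-refl
  *ₚ-congʳ (_ ∷ p) q≋q′ = +ₚ-cong (scale-cong refl q≋q′) (∷-cong refl (*ₚ-congʳ p q≋q′))

  *ₚ-zeroʳ : ∀ p → p *ₚ [] ≋ []
  *ₚ-zeroʳ []      = ≋-refl
  *ₚ-zeroʳ (_ ∷ p) = ∷-≋-[] refl (*ₚ-zeroʳ p)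

  *ₚ-distribʳ : ∀ q p p′ → (p +ₚ p′) *ₚ q ≋ p *ₚ q +ₚ p′ *ₚ q
  *ₚ-distribʳ q []      _        = ≋-refl
  *ₚ-distribʳ q (_ ∷ _) []       = ≋-sym (+ₚ-identityʳ _)
  *ₚ-distribʳ q (a ∷ p) (b ∷ p′) = ≋-trans
    (+ₚ-cong (scale-distribʳ a b q)
             (≋-trans (∷-cong refl (*ₚ-distribʳ q p p′)) (0∷-+ₚ (p *ₚ q) (p′ *ₚ q))))
    (+ₚ-interchange (scale a q) (scale b q) (0# ∷ p *ₚ q) (0# ∷ p′ *ₚ q))

  +ₚ-leftSwap : ∀ p q r → p +ₚ (q +ₚ r) ≋ q +ₚ (p +ₚ r)
  +ₚ-leftSwap p q r = ≋-trans (≋-sym (+ₚ-assoc p q r))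
    (≋-trans (+ₚ-cong (+ₚ-comm p q) ≋-refl) (+ₚ-assoc q p r))

  scale-0∷ : ∀ a s → scale a (0# ∷ s) ≋ 0# ∷ scale a s
  scale-0∷ a _ = ∷-cong (zeroʳ a) ≋-refl

  *ₚ-scaleˡ : ∀ a p q → scale a p *ₚ q ≋ scale a (p *ₚ q)
  *ₚ-scaleˡ a []      q = ≋-refl
  *ₚ-scaleˡ a (b ∷ p) q = ≋-trans
    (+ₚ-cong (≋-sym (scale-assoc a b q))
             (≋-trans (∷-cong refl (*ₚ-scaleˡ a p q)) (≋-sym (scale-0∷ a (p *ₚ q)))))
    (≋-sym (scale-distribˡ a (scale b q) (0# ∷ p *ₚ q)))

  *ₚ-0∷ˡ : ∀ s q → (0# ∷ s) *ₚ q ≋ 0# ∷ s *ₚ q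
  *ₚ-0∷ˡ _ q = +ₚ-cong (scale-zero q) ≋-refl

  *ₚ-∷ʳ : ∀ p b q → p *ₚ (b ∷ q) ≋ scale b p +ₚ (0# ∷ p *ₚ q)
  *ₚ-∷ʳ []      _ _ = ≋-sym (∷-≋-[] refl ≋-refl)
  *ₚ-∷ʳ (a ∷ p) b q = ∷-cong (+-congʳ (*-comm a b))
    (≋-trans (+ₚ-cong ≋-refl (*ₚ-∷ʳ p b q)) (+ₚ-leftSwap (scale a q) (scale b p) (0# ∷ p *ₚ q)))

  *ₚ-comm : ∀ p q → p *ₚ q ≋ q *ₚ p
  *ₚ-comm []      q = ≋-sym (*ₚ-zeroʳ q)
  *ₚ-comm (a ∷ p) q =
    ≋-trans (+ₚ-cong ≋-refl (∷-cong refl (*ₚ-comm p q))) (≋-sym (*ₚ-∷ʳ q a p))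

  *ₚ-assoc : ∀ p q r → (p *ₚ q) *ₚ r ≋ p *ₚ (q *ₚ r)
  *ₚ-assoc []      q r = ≋-refl
  *ₚ-assoc (a ∷ p) q r = ≋-trans (*ₚ-distribʳ r (scale a q) (0# ∷ p *ₚ q))
    (+ₚ-cong (*ₚ-scaleˡ a q r) (≋-trans (*ₚ-0∷ˡ (p *ₚ q) r) (∷-cong refl (*ₚ-assoc p q r))))

  *ₚ-identityˡ : ∀ q → 1ₚ *ₚ q ≋ q
  *ₚ-identityˡ q = ≋-trans (+ₚ-cong (scale-identity q) (∷-≋-[] refl ≋-refl)) (+ₚ-identityʳ q)

  *ₚ-identityʳ : ∀ q → q *ₚ 1ₚ ≋ q
  *ₚ-identityʳ q = ≋-trans (*ₚ-comm q 1ₚ) (*ₚ-identityˡ q)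

  *ₚ-distribˡ : ∀ p q r → p *ₚ (q +ₚ r) ≋ p *ₚ q +ₚ p *ₚ r
  *ₚ-distribˡ p q r = ≋-trans (*ₚ-comm p (q +ₚ r))
    (≋-trans (*ₚ-distribʳ p q r) (+ₚ-cong (*ₚ-comm q p) (*ₚ-comm r p)))

  polynomial-isCommutativeRing : IsCommutativeRing _≋_ _+ₚ_ _*ₚ_ -ₚ_ [] 1ₚ
  polynomial-isCommutativeRing = record
    { isRing = record
      { +-isAbelianGroup = record
        { isGroup = record
          { isMonoid = record
            { isSemigroup = record
              { isMagma = record { isEquivalence = ≋-isEquivalence ; ∙-cong = +ₚ-cong }
              ; assoc = +ₚ-assoc }
            ; identity = (λ _ → ≋-refl) , +ₚ-identityʳ }
          ; inverse = -ₚ-inverseˡ , -ₚ-inverseʳ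
          ; ⁻¹-cong = -ₚ-cong }
        ; comm = +ₚ-comm }
      ; *-cong = λ {p} {_} {_} {q′} p≋p′ q≋q′ → ≋-trans (*ₚ-congʳ p q≋q′) (*ₚ-congˡ q′ p≋p′)
      ; *-assoc = *ₚ-assoc
      ; *-identity = *ₚ-identityˡ , *ₚ-identityʳ
      ; distrib = *ₚ-distribˡ , *ₚ-distribʳ }
    ; *-comm = *ₚ-comm }

  polynomialRing : CommutativeRing c ℓ
  polynomialRing = record { isCommutativeRing = polynomial-isCommutativeRing }

module Polynomials {c ℓ : Level} (K : Field c ℓ) where
  open PolynomialRing K public
    using ( Pol; _≋_; coeff-≈; ∷-cong; ∷-≋-[]; ∷-≋-[]⁻ʰ; ∷-≋-[]⁻ᵗ; ∷-≋-∷⁻ᵗ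
          ; scale; *ₚ-0∷ˡ; polynomialRing )
  private module F = CommutativeRing (Field.commutativeRing K)
  open CommutativeRing polynomialRing
  open import Algebra.Properties.CommutativeSemigroup +-commutativeSemigroup
    using () renaming (interchange to +-interchange)
  open import Algebra.Properties.CommutativeSemigroup *-commutativeSemigroup
    using (x∙yz≈y∙xz)
  open import Algebra.Properties.Ring ring using (-‿distribʳ-*)
  open import Algebra.Properties.AbelianGroup +-abelianGroup
    using (⁻¹-∙-comm; x∙y⁻¹≈ε⇒x≈y; x≈y⇒x∙y⁻¹≈ε)
  open import Relation.Binary.Reasoning.Setoid setoid
  open Cancellation polynomialRing public

  -- The operations of Defs recurse on their first argument, so operands often
  -- cannot be recovered by unification; hence the explicit implicit arguments
  -- given to congruence lemmas from here on.

  infixl 8 _∘ₚ_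

  _∘ₚ_ : Pol → Pol → Pol
  _∘ₚ_ = _∘P_ K

  [_] : F.Carrier → Pol
  [_] = constP K

  [_]-* : ∀ a p → [ a ] * p ≈ scale a p
  [ a ]-* p = trans (+-congˡ {scale a p} (∷-≋-[] F.refl refl)) (+-identityʳ (scale a p))

  ∘ₚ-zero : ∀ {p} g → p ≈ [] → p ∘ₚ g ≈ []
  ∘ₚ-zero {[]}    g _      = refl
  ∘ₚ-zero {a ∷ p} g a∷p≈[] = +-cong (∷-≋-[] (∷-≋-[]⁻ʰ a∷p≈[]) refl)
    (trans (*-congˡ {g} (∘ₚ-zero g (∷-≋-[]⁻ᵗ a∷p≈[]))) (zeroʳ g))

  ∘ₚ-cong : ∀ {p p′} g → p ≈ p′ → p ∘ₚ g ≈ p′ ∘ₚ g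
  ∘ₚ-cong {[]}    {_}     g p≈p′ = sym (∘ₚ-zero g (sym p≈p′))
  ∘ₚ-cong {_ ∷ _} {[]}    g p≈p′ = ∘ₚ-zero g p≈p′
  ∘ₚ-cong {_ ∷ p} {_ ∷ p′} g p≈p′ = +-cong (∷-cong (coeff-≈ p≈p′ 0) refl)
    (*-congˡ {g} (∘ₚ-cong {p} {p′} g (∷-≋-∷⁻ᵗ p≈p′)))

  ∘ₚ-+ : ∀ p p′ g → (p + p′) ∘ₚ g ≈ p ∘ₚ g + p′ ∘ₚ g
  ∘ₚ-+ []      _        _ = refl
  ∘ₚ-+ (_ ∷ _) []       _ = sym (+-identityʳ _)
  ∘ₚ-+ (a ∷ p) (b ∷ p′) g = begin
    [ a ] + [ b ] + g * (p + p′) ∘ₚ g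
      ≈⟨ +-congˡ {[ a ] + [ b ]} (*-congˡ {g} (∘ₚ-+ p p′ g)) ⟩
    [ a ] + [ b ] + g * (p ∘ₚ g + p′ ∘ₚ g)
      ≈⟨ +-congˡ {[ a ] + [ b ]} (distribˡ g (p ∘ₚ g) (p′ ∘ₚ g)) ⟩
    [ a ] + [ b ] + (g * p ∘ₚ g + g * p′ ∘ₚ g)
      ≈⟨ +-interchange [ a ] [ b ] (g * p ∘ₚ g) (g * p′ ∘ₚ g) ⟩
    ([ a ] + g * p ∘ₚ g) + ([ b ] + g * p′ ∘ₚ g)
      ∎

  ∘ₚ-const : ∀ a g → [ a ] ∘ₚ g ≈ [ a ]
  ∘ₚ-const a g = trans (+-congˡ {[ a ]} (zeroʳ g)) (+-identityʳ [ a ])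

  ∘ₚ-0∷ : ∀ s g → (F.0# ∷ s) ∘ₚ g ≈ g * s ∘ₚ g
  ∘ₚ-0∷ s g = +-congʳ {g * s ∘ₚ g} (∷-≋-[] F.refl refl)

  ∘ₚ-scale : ∀ a q g → scale a q ∘ₚ g ≈ [ a ] * q ∘ₚ g
  ∘ₚ-scale a []      g = sym (zeroʳ [ a ])
  ∘ₚ-scale a (b ∷ q) g = begin
    [ a F.* b ] + g * scale a q ∘ₚ g
      ≈⟨ +-cong (sym ([ a ]-* [ b ])) (*-congˡ {g} (∘ₚ-scale a q g)) ⟩
    [ a ] * [ b ] + g * ([ a ] * q ∘ₚ g)
      ≈⟨ +-congˡ {[ a ] * [ b ]} (x∙yz≈y∙xz g [ a ] (q ∘ₚ g)) ⟩
    [ a ] * [ b ] + [ a ] * (g * q ∘ₚ g)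
      ≈⟨ distribˡ [ a ] [ b ] (g * q ∘ₚ g) ⟨
    [ a ] * ([ b ] + g * q ∘ₚ g)
      ∎

  ∘ₚ-* : ∀ p q g → (p * q) ∘ₚ g ≈ p ∘ₚ g * q ∘ₚ g
  ∘ₚ-* []      q g = refl
  ∘ₚ-* (a ∷ p) q g = begin
    (scale a q + (F.0# ∷ p * q)) ∘ₚ g
      ≈⟨ ∘ₚ-+ (scale a q) (F.0# ∷ p * q) g ⟩
    scale a q ∘ₚ g + (F.0# ∷ p * q) ∘ₚ g
      ≈⟨ +-cong (∘ₚ-scale a q g) (∘ₚ-0∷ (p * q) g) ⟩
    [ a ] * q ∘ₚ g + g * (p * q) ∘ₚ g
      ≈⟨ +-congˡ {[ a ] * q ∘ₚ g} (*-congˡ {g} (∘ₚ-* p q g)) ⟩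
    [ a ] * q ∘ₚ g + g * (p ∘ₚ g * q ∘ₚ g)
      ≈⟨ +-congˡ {[ a ] * q ∘ₚ g} (*-assoc g (p ∘ₚ g) (q ∘ₚ g)) ⟨
    [ a ] * q ∘ₚ g + g * p ∘ₚ g * q ∘ₚ g
      ≈⟨ distribʳ (q ∘ₚ g) [ a ] (g * p ∘ₚ g) ⟨
    ([ a ] + g * p ∘ₚ g) * q ∘ₚ g
      ∎

  ∘ₚ-neg : ∀ p g → (- p) ∘ₚ g ≈ - (p ∘ₚ g)
  ∘ₚ-neg []      g = refl
  ∘ₚ-neg (a ∷ p) g = begin
    - [ a ] + g * (- p) ∘ₚ g    ≈⟨ +-congˡ { - [ a ]} (*-congˡ {g} (∘ₚ-neg p g)) ⟩
    - [ a ] + g * - (p ∘ₚ g)    ≈⟨ +-congˡ { - [ a ]} (-‿distribʳ-* g (p ∘ₚ g)) ⟨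
    - [ a ] + - (g * p ∘ₚ g)    ≈⟨ ⁻¹-∙-comm [ a ] (g * p ∘ₚ g) ⟩
    - ([ a ] + g * p ∘ₚ g)      ∎

  X^-+ : ∀ m n → X^ K (m ℕ.+ n) ≈ X^ K m * X^ K n
  X^-+ zero    n = sym (*-identityˡ (X^ K n))
  X^-+ (suc m) n = trans (∷-cong F.refl (X^-+ m n)) (sym (*ₚ-0∷ˡ (X^ K m) (X^ K n)))

  X^-∘ₚ : ∀ q n → X^ K n ∘ₚ X^ K q ≈ X^ K (q ℕ.* n)
  X^-∘ₚ q zero    = trans (∘ₚ-const F.1# (X^ K q)) (reflexive (≡.cong (X^ K) (≡.sym (ℕ.*-zeroʳ q))))
  X^-∘ₚ q (suc n) = begin
    X^ K (suc n) ∘ₚ X^ K q       ≈⟨ ∘ₚ-0∷ (X^ K n) (X^ K q) ⟩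
    X^ K q * X^ K n ∘ₚ X^ K q    ≈⟨ *-congˡ {X^ K q} (X^-∘ₚ q n) ⟩
    X^ K q * X^ K (q ℕ.* n)      ≈⟨ X^-+ q (q ℕ.* n) ⟨
    X^ K (q ℕ.+ q ℕ.* n)         ≡⟨ ≡.cong (X^ K) (ℕ.*-suc q n) ⟨
    X^ K (q ℕ.* suc n)           ∎

  IsZeroP⇒≈[] : ∀ {p} → IsZeroP K p → p ≈ []
  IsZeroP⇒≈[] []           = refl
  IsZeroP⇒≈[] (a≈0 ∷ p≈0) = ∷-≋-[] a≈0 (IsZeroP⇒≈[] p≈0)

  ≈[]⇒IsZeroP : ∀ {p} → p ≈ [] → IsZeroP K p
  ≈[]⇒IsZeroP {[]}    _      = []
  ≈[]⇒IsZeroP {_ ∷ _} a∷p≈[] = ∷-≋-[]⁻ʰ a∷p≈[] ∷ ≈[]⇒IsZeroP (∷-≋-[]⁻ᵗ a∷p≈[])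

  ≈P⇒≈ : ∀ p q → _≈P_ K p q → p ≈ q
  ≈P⇒≈ p q p-q≈0 = x∙y⁻¹≈ε⇒x≈y p q (IsZeroP⇒≈[] p-q≈0)

  ≈⇒≈P : ∀ {p q} → p ≈ q → _≈P_ K p q
  ≈⇒≈P p≈q = ≈[]⇒IsZeroP (x≈y⇒x∙y⁻¹≈ε p≈q)

  X^-cancellable : ∀ n → Cancellable (X^ K n)
  X^-cancellable n = annihilatorFree⇒cancellable λ s sXⁿ≈0 → X^*-annihilatorFree n s
    (trans (*-comm (X^ K n) s) sXⁿ≈0)
    where
    X^*-annihilatorFree : ∀ n s → X^ K n * s ≈ [] → s ≈ []
    X^*-annihilatorFree zero    s 1s≈0   = trans (sym (*-identityˡ s)) 1s≈0
    X^*-annihilatorFree (suc n) s tXⁿs≈0 = X^*-annihilatorFree n s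
      (∷-≋-[]⁻ᵗ (trans (sym (*ₚ-0∷ˡ (X^ K n) s)) tXⁿs≈0))

  ∘X^suc-kernel : ∀ q p → p ∘ₚ X^ K (suc q) ≈ [] → p ≈ []
  ∘X^suc-kernel q []      _         = refl
  ∘X^suc-kernel q (a ∷ p) a∷p∘t≈[] = ∷-≋-[]
    (F.trans (F.sym (F.+-identityʳ a)) (∷-≋-[]⁻ʰ a+t[p∘t]≈[]))
    (∘X^suc-kernel q p (X^-cancellable q (p ∘ₚ t) []
      (trans (*-comm (p ∘ₚ t) (X^ K q)) (∷-≋-[]⁻ᵗ a+t[p∘t]≈[]))))
    where
    t = X^ K (suc q)
    a+t[p∘t]≈[] : (a F.+ F.0#) ∷ X^ K q * p ∘ₚ t ≈ []
    a+t[p∘t]≈[] = trans (sym (+-congˡ {[ a ]} (*ₚ-0∷ˡ (X^ K q) (p ∘ₚ t)))) a∷p∘t≈[]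

  ∘X^suc-injective : ∀ q p p′ → p ∘ₚ X^ K (suc q) ≈ p′ ∘ₚ X^ K (suc q) → p ≈ p′
  ∘X^suc-injective q p p′ p∘t≈p′∘t = x∙y⁻¹≈ε⇒x≈y p p′ (∘X^suc-kernel q (p - p′) (begin
    (p - p′) ∘ₚ t           ≈⟨ ∘ₚ-+ p (- p′) t ⟩
    p ∘ₚ t + (- p′) ∘ₚ t    ≈⟨ +-congˡ {p ∘ₚ t} (∘ₚ-neg p′ t) ⟩
    p ∘ₚ t - p′ ∘ₚ t        ≈⟨ x≈y⇒x∙y⁻¹≈ε p∘t≈p′∘t ⟩
    []                      ∎))
    where t = X^ K (suc q)

module Fractions {c ℓ : Level} (K : Field c ℓ) where
  open Polynomials K
  open CommutativeRing polynomialRing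
  open ScaledEquations polynomialRing
  open import Relation.Binary.Reasoning.Setoid setoid

  infixl 6 _+ᵣ_ _-ᵣ_
  infixl 7 _*ᵣ_
  infix  8 -ᵣ_
  infix  4 _≈ᵣ_ _≅_

  _+ᵣ_ _-ᵣ_ _*ᵣ_ : RatF K → RatF K → RatF K
  _+ᵣ_ = _+R_ K
  _-ᵣ_ = _-R_ K
  _*ᵣ_ = _*R_ K

  -ᵣ_ : RatF K → RatF K
  -ᵣ_ = -R_ K

  _≈ᵣ_ : RatF K → RatF K → Set (c ⊔ ℓ)
  _≈ᵣ_ = _≈R_ K

  ≈ᵣ⇒cross : ∀ f g → f ≈ᵣ g → num f * den g ≈ num g * den f
  ≈ᵣ⇒cross f g = ≈P⇒≈ (num f * den g) (num g * den f)

  cross⇒≈ᵣ : ∀ f g → num f * den g ≈ num g * den f → f ≈ᵣ g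
  cross⇒≈ᵣ f g = ≈⇒≈P

  record _≅_ (f g : RatF K) : Set (c ⊔ ℓ) where
    field
      scaleˡ scaleʳ      : Pol
      scaleˡ-cancellable : Cancellable scaleˡ
      scaleʳ-cancellable : Cancellable scaleʳ
      num-≈              : num f * scaleˡ ≈ num g * scaleʳ
      den-≈              : den f * scaleˡ ≈ den g * scaleʳ
  open _≅_

  ≈⇒≅ : ∀ {f g} → num f ≈ num g → den f ≈ den g → f ≅ g
  ≈⇒≅ num≈ den≈ = record
    { scaleˡ = 1# ; scaleʳ = 1#
    ; scaleˡ-cancellable = 1#-cancellable ; scaleʳ-cancellable = 1#-cancellable
    ; num-≈ = *-congʳ num≈ ; den-≈ = *-congʳ den≈ }

  ≅-refl : ∀ {f} → f ≅ f
  ≅-refl = ≈⇒≅ refl refl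

  ≅-sym : ∀ {f g} → f ≅ g → g ≅ f
  ≅-sym f≅g = record
    { scaleˡ = scaleʳ f≅g ; scaleʳ = scaleˡ f≅g
    ; scaleˡ-cancellable = scaleʳ-cancellable f≅g ; scaleʳ-cancellable = scaleˡ-cancellable f≅g
    ; num-≈ = sym (num-≈ f≅g) ; den-≈ = sym (den-≈ f≅g) }

  ≅-trans : ∀ {f g h} → f ≅ g → g ≅ h → f ≅ h
  ≅-trans {f} {g} {h} f≅g g≅h = record
    { scaleˡ = scaleˡ f≅g * scaleˡ g≅h ; scaleʳ = scaleʳ g≅h * scaleʳ f≅g
    ; scaleˡ-cancellable = *-cancellable (scaleˡ-cancellable f≅g) (scaleˡ-cancellable g≅h)
    ; scaleʳ-cancellable = *-cancellable (scaleʳ-cancellable g≅h) (scaleʳ-cancellable f≅g)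
    ; num-≈ = scaled-trans (num f) (num g) (num h) (num-≈ f≅g) (num-≈ g≅h)
    ; den-≈ = scaled-trans (den f) (den g) (den h) (den-≈ f≅g) (den-≈ g≅h) }

  +ᵣ-cong : ∀ {f f′ g g′} → f ≅ f′ → g ≅ g′ → f +ᵣ g ≅ f′ +ᵣ g′
  +ᵣ-cong {f} {f′} {g} {g′} f≅f′ g≅g′ = record
    { scaleˡ = scaleˡ f≅f′ * scaleˡ g≅g′ ; scaleʳ = scaleʳ f≅f′ * scaleʳ g≅g′
    ; scaleˡ-cancellable = *-cancellable (scaleˡ-cancellable f≅f′) (scaleˡ-cancellable g≅g′)
    ; scaleʳ-cancellable = *-cancellable (scaleʳ-cancellable f≅f′) (scaleʳ-cancellable g≅g′)
    ; num-≈ = scaled-+ (num f) (num f′) (den f) (den f′) (num g) (num g′) (den g) (den g′)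
                       (num-≈ f≅f′) (den-≈ f≅f′) (num-≈ g≅g′) (den-≈ g≅g′)
    ; den-≈ = scaled-* (den f) (den f′) (den g) (den g′) (den-≈ f≅f′) (den-≈ g≅g′) }

  *ᵣ-cong : ∀ {f f′ g g′} → f ≅ f′ → g ≅ g′ → f *ᵣ g ≅ f′ *ᵣ g′
  *ᵣ-cong {f} {f′} {g} {g′} f≅f′ g≅g′ = record
    { scaleˡ = scaleˡ f≅f′ * scaleˡ g≅g′ ; scaleʳ = scaleʳ f≅f′ * scaleʳ g≅g′
    ; scaleˡ-cancellable = *-cancellable (scaleˡ-cancellable f≅f′) (scaleˡ-cancellable g≅g′)
    ; scaleʳ-cancellable = *-cancellable (scaleʳ-cancellable f≅f′) (scaleʳ-cancellable g≅g′)
    ; num-≈ = scaled-* (num f) (num f′) (num g) (num g′) (num-≈ f≅f′) (num-≈ g≅g′)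
    ; den-≈ = scaled-* (den f) (den f′) (den g) (den g′) (den-≈ f≅f′) (den-≈ g≅g′) }

  -ᵣ-cong : ∀ {f f′} → f ≅ f′ → -ᵣ f ≅ -ᵣ f′
  -ᵣ-cong {f} {f′} f≅f′ = record
    { scaleˡ = scaleˡ f≅f′ ; scaleʳ = scaleʳ f≅f′
    ; scaleˡ-cancellable = scaleˡ-cancellable f≅f′ ; scaleʳ-cancellable = scaleʳ-cancellable f≅f′
    ; num-≈ = scaled-neg (num f) (num f′) (num-≈ f≅f′) ; den-≈ = den-≈ f≅f′ }

  ≈ᵣ-resp-≅ : ∀ {f f′ g g′} → f ≅ f′ → g ≅ g′ → f ≈ᵣ g → f′ ≈ᵣ g′
  ≈ᵣ-resp-≅ {f} {f′} {g} {g′} f≅f′ g≅g′ f≈g = cross⇒≈ᵣ f′ g′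
    (*-cancellable (scaleʳ-cancellable f≅f′) (scaleʳ-cancellable g≅g′)
      (num f′ * den g′) (num g′ * den f′) (begin
        (num f′ * den g′) * (sʳf * sʳg)
          ≈⟨ scaled-* (num f) (num f′) (den g) (den g′) (num-≈ f≅f′) (den-≈ g≅g′) ⟨
        (num f * den g) * (sˡf * sˡg)
          ≈⟨ *-congʳ {sˡf * sˡg} (≈ᵣ⇒cross f g f≈g) ⟩
        (num g * den f) * (sˡf * sˡg)
          ≈⟨ *-congˡ {num g * den f} (*-comm sˡf sˡg) ⟩
        (num g * den f) * (sˡg * sˡf)
          ≈⟨ scaled-* (num g) (num g′) (den f) (den f′) (num-≈ g≅g′) (den-≈ f≅f′) ⟩
        (num g′ * den f′) * (sʳg * sʳf)
          ≈⟨ *-congˡ {num g′ * den f′} (*-comm sʳg sʳf) ⟩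
        (num g′ * den f′) * (sʳf * sʳg)
          ∎))
    where
    sˡf = scaleˡ f≅f′
    sʳf = scaleʳ f≅f′
    sˡg = scaleˡ g≅g′
    sʳg = scaleʳ g≅g′

module Substitution {c ℓ : Level} (K : Field c ℓ) (q′ : ℕ) where
  open Polynomials K
  open Fractions K public
  private module F = CommutativeRing (Field.commutativeRing K)
  open CommutativeRing polynomialRing
  open import Algebra.Properties.CommutativeSemigroup *-commutativeSemigroup
    using (interchange)
  open import Relation.Binary.Reasoning.Setoid setoid

  q : ℕ
  q = suc q′

  ψ : Pol → Pol
  ψ p = p ∘ₚ X^ K q

  -- Written so that φ K q r (pt f g) is definitionally
  -- pt (τ (2 ℕ.* r) f) (τ (3 ℕ.* r) g).
  τ : ℕ → RatF K → RatF K
  τ w f = num (subR K q f) /R (den (subR K q f) * X^ K w)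

  τ-cross : ∀ w f g → num (τ w f) * den (τ w g) ≈ ψ (num f * den g) * X^ K w
  τ-cross w f g = begin
    ψ (num f) * (ψ (den g) * X^ K w)   ≈⟨ *-assoc (ψ (num f)) (ψ (den g)) (X^ K w) ⟨
    ψ (num f) * ψ (den g) * X^ K w     ≈⟨ *-congʳ {X^ K w} (∘ₚ-* (num f) (den g) (X^ K q)) ⟨
    ψ (num f * den g) * X^ K w         ∎

  τ-valid : ∀ w f → ValidR K f → ValidR K (τ w f)
  τ-valid w f f-valid τf-zero = f-valid (≈[]⇒IsZeroP (∘X^suc-kernel q′ (den f)
    (X^-cancellable w (ψ (den f)) [] (IsZeroP⇒≈[] τf-zero))))

  τ-≈ᵣ : ∀ w f g → f ≈ᵣ g → τ w f ≈ᵣ τ w g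
  τ-≈ᵣ w f g f≈g = cross⇒≈ᵣ (τ w f) (τ w g) (begin
    num (τ w f) * den (τ w g)    ≈⟨ τ-cross w f g ⟩
    ψ (num f * den g) * X^ K w   ≈⟨ *-congʳ {X^ K w} (∘ₚ-cong (X^ K q) (≈ᵣ⇒cross f g f≈g)) ⟩
    ψ (num g * den f) * X^ K w   ≈⟨ τ-cross w g f ⟨
    num (τ w g) * den (τ w f)    ∎)

  τ-≈ᵣ⁻¹ : ∀ w f g → τ w f ≈ᵣ τ w g → f ≈ᵣ g
  τ-≈ᵣ⁻¹ w f g τf≈τg = cross⇒≈ᵣ f g (∘X^suc-injective q′ (num f * den g) (num g * den f)
    (X^-cancellable w (ψ (num f * den g)) (ψ (num g * den f)) (begin
      ψ (num f * den g) * X^ K w   ≈⟨ τ-cross w f g ⟨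
      num (τ w f) * den (τ w g)    ≈⟨ ≈ᵣ⇒cross (τ w f) (τ w g) τf≈τg ⟩
      num (τ w g) * den (τ w f)    ≈⟨ τ-cross w g f ⟩
      ψ (num g * den f) * X^ K w   ∎)))

  τ-+-distrib : ∀ w f g → τ w (f +ᵣ g) ≅ τ w f +ᵣ τ w g
  τ-+-distrib w f g = record
    { scaleˡ = X^ K w ; scaleʳ = 1#
    ; scaleˡ-cancellable = X^-cancellable w ; scaleʳ-cancellable = 1#-cancellable
    ; num-≈ = begin
        ψ (num f * den g + num g * den f) * X^ K w
          ≈⟨ *-congʳ {X^ K w} (∘ₚ-+ (num f * den g) (num g * den f) (X^ K q)) ⟩
        (ψ (num f * den g) + ψ (num g * den f)) * X^ K w
          ≈⟨ distribʳ (X^ K w) (ψ (num f * den g)) (ψ (num g * den f)) ⟩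
        ψ (num f * den g) * X^ K w + ψ (num g * den f) * X^ K w
          ≈⟨ +-cong (τ-cross w f g) (τ-cross w g f) ⟨
        num (τ w f) * den (τ w g) + num (τ w g) * den (τ w f)
          ≈⟨ *-identityʳ _ ⟨
        (num (τ w f) * den (τ w g) + num (τ w g) * den (τ w f)) * 1#
          ∎
    ; den-≈ = begin
        ψ (den f * den g) * X^ K w * X^ K w
          ≈⟨ *-congʳ {X^ K w} (*-congʳ {X^ K w} (∘ₚ-* (den f) (den g) (X^ K q))) ⟩
        ψ (den f) * ψ (den g) * X^ K w * X^ K w
          ≈⟨ *-assoc (ψ (den f) * ψ (den g)) (X^ K w) (X^ K w) ⟩
        ψ (den f) * ψ (den g) * (X^ K w * X^ K w)
          ≈⟨ interchange (ψ (den f)) (ψ (den g)) (X^ K w) (X^ K w) ⟩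
        ψ (den f) * X^ K w * (ψ (den g) * X^ K w)
          ≈⟨ *-identityʳ _ ⟨
        ψ (den f) * X^ K w * (ψ (den g) * X^ K w) * 1#
          ∎ }

  τ-*-distrib : ∀ u v f g → τ (u ℕ.+ v) (f *ᵣ g) ≅ τ u f *ᵣ τ v g
  τ-*-distrib u v f g = ≈⇒≅ (∘ₚ-* (num f) (num g) (X^ K q)) (begin
    ψ (den f * den g) * X^ K (u ℕ.+ v)
      ≈⟨ *-cong (∘ₚ-* (den f) (den g) (X^ K q)) (X^-+ u v) ⟩
    ψ (den f) * ψ (den g) * (X^ K u * X^ K v)
      ≈⟨ interchange (ψ (den f)) (ψ (den g)) (X^ K u) (X^ K v) ⟩
    ψ (den f) * X^ K u * (ψ (den g) * X^ K v)
      ∎)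

  τ-neg-distrib : ∀ w f → τ w (-ᵣ f) ≅ -ᵣ τ w f
  τ-neg-distrib w f = ≈⇒≅ (∘ₚ-neg (num f) (X^ K q)) refl

  τ-X^*-shift : ∀ k w f → τ (q ℕ.* k ℕ.+ w) (XR^ K k *ᵣ f) ≅ τ w f
  τ-X^*-shift k w f = record
    { scaleˡ = 1# ; scaleʳ = X^ K (q ℕ.* k)
    ; scaleˡ-cancellable = 1#-cancellable ; scaleʳ-cancellable = X^-cancellable (q ℕ.* k)
    ; num-≈ = begin
        ψ (X^ K k * num f) * 1#          ≈⟨ *-identityʳ _ ⟩
        ψ (X^ K k * num f)               ≈⟨ ∘ₚ-* (X^ K k) (num f) (X^ K q) ⟩
        ψ (X^ K k) * ψ (num f)           ≈⟨ *-congʳ {ψ (num f)} (X^-∘ₚ q k) ⟩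
        X^ K (q ℕ.* k) * ψ (num f)       ≈⟨ *-comm (X^ K (q ℕ.* k)) (ψ (num f)) ⟩
        ψ (num f) * X^ K (q ℕ.* k)       ∎
    ; den-≈ = begin
        ψ (1# * den f) * X^ K (q ℕ.* k ℕ.+ w) * 1#
          ≈⟨ *-identityʳ _ ⟩
        ψ (1# * den f) * X^ K (q ℕ.* k ℕ.+ w)
          ≈⟨ *-cong (∘ₚ-cong (X^ K q) (*-identityˡ (den f))) (X^-+ (q ℕ.* k) w) ⟩
        ψ (den f) * (X^ K (q ℕ.* k) * X^ K w)
          ≈⟨ *-congˡ {ψ (den f)} (*-comm (X^ K (q ℕ.* k)) (X^ K w)) ⟩
        ψ (den f) * (X^ K w * X^ K (q ℕ.* k))
          ≈⟨ *-assoc (ψ (den f)) (X^ K w) (X^ K (q ℕ.* k)) ⟨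
        ψ (den f) * X^ K w * X^ K (q ℕ.* k)
          ∎ }

  τ-const : ∀ a b → τ 0 ([ a ] /R [ b ]) ≅ [ a ] /R [ b ]
  τ-const a b = ≈⇒≅ (∘ₚ-const a (X^ K q)) (trans (*-identityʳ _) (∘ₚ-const b (X^ K q)))

  τ-XR^ : ∀ n → τ 0 (XR^ K n) ≅ XR^ K (q ℕ.* n)
  τ-XR^ n = ≈⇒≅ (X^-∘ₚ q n) (trans (*-identityʳ _) (∘ₚ-const F.1# (X^ K q)))

  τ-zero : ∀ w → τ w (ℕ→R K 0) ≅ ℕ→R K 0
  τ-zero w = record
    { scaleˡ = 1# ; scaleʳ = X^ K w
    ; scaleˡ-cancellable = 1#-cancellable ; scaleʳ-cancellable = X^-cancellable w
    ; num-≈ = begin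
        ψ [ F.0# ] * 1#      ≈⟨ *-identityʳ _ ⟩
        ψ [ F.0# ]           ≈⟨ ∘ₚ-const F.0# (X^ K q) ⟩
        [ F.0# ]             ≈⟨ [0]≈0 ⟩
        []                   ≈⟨ *-congʳ {X^ K w} [0]≈0 ⟨
        [ F.0# ] * X^ K w    ∎
    ; den-≈ = trans (*-identityʳ _) (*-congʳ {X^ K w} (∘ₚ-const F.1# (X^ K q))) }
    where
    [0]≈0 : [ F.0# ] ≈ []
    [0]≈0 = ∷-≋-[] F.refl refl

  infix 4 _↦[_]_

  -- A record rather than τ w f ≅ f′ itself: τ unfolds, and f and w could no
  -- longer be inferred from the type.
  record _↦[_]_ (f : RatF K) (w : ℕ) (f′ : RatF K) : Set (c ⊔ ℓ) where
    constructor image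
    field τ≅ : τ w f ≅ f′

  ↦-refl : ∀ {f w} → f ↦[ w ] τ w f
  ↦-refl = image ≅-refl

  ↦-+ : ∀ {f f′ g g′ w} → f ↦[ w ] f′ → g ↦[ w ] g′ → f +ᵣ g ↦[ w ] f′ +ᵣ g′
  ↦-+ {f} {_} {g} {_} {w} (image f↦) (image g↦) =
    image (≅-trans (τ-+-distrib w f g) (+ᵣ-cong f↦ g↦))

  ↦-neg : ∀ {f f′ w} → f ↦[ w ] f′ → -ᵣ f ↦[ w ] -ᵣ f′
  ↦-neg {f} {_} {w} (image f↦) = image (≅-trans (τ-neg-distrib w f) (-ᵣ-cong f↦))

  ↦-sub : ∀ {f f′ g g′ w} → f ↦[ w ] f′ → g ↦[ w ] g′ → f -ᵣ g ↦[ w ] f′ -ᵣ g′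
  ↦-sub f↦ g↦ = ↦-+ f↦ (↦-neg g↦)

  ↦-* : ∀ {f f′ g g′ u v w} → u ℕ.+ v ≡ w → f ↦[ u ] f′ → g ↦[ v ] g′ → f *ᵣ g ↦[ w ] f′ *ᵣ g′
  ↦-* {f} {_} {g} {_} {u} {v} ≡.refl (image f↦) (image g↦) =
    image (≅-trans (τ-*-distrib u v f g) (*ᵣ-cong f↦ g↦))

  ↦-X^* : ∀ {f f′} k {w w′} → q ℕ.* k ℕ.+ w ≡ w′ → f ↦[ w ] f′ → XR^ K k *ᵣ f ↦[ w′ ] f′
  ↦-X^* {f} k {w} ≡.refl (image f↦) = image (≅-trans (τ-X^*-shift k w f) f↦)

  ↦-ℕ : ∀ n → ℕ→R K n ↦[ 0 ] ℕ→R K n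
  ↦-ℕ n = image (τ-const _ _)

  ↦-ℚ : ∀ A → ℚ→R K A ↦[ 0 ] ℚ→R K A
  ↦-ℚ A = image (τ-const _ _)

  ↦-XR^ : ∀ {n n′} → q ℕ.* n ≡ n′ → XR^ K n ↦[ 0 ] XR^ K n′
  ↦-XR^ {n} ≡.refl = image (τ-XR^ n)

  ↦-zero : ∀ w → ℕ→R K 0 ↦[ w ] ℕ→R K 0
  ↦-zero w = image (τ-zero w)

  ↦-preserves-≈ᵣ : ∀ {f f′ g g′ w} → f ↦[ w ] f′ → g ↦[ w ] g′ → f ≈ᵣ g → f′ ≈ᵣ g′
  ↦-preserves-≈ᵣ {f} {_} {g} {_} {w} (image f↦) (image g↦) f≈g =
    ≈ᵣ-resp-≅ f↦ g↦ (τ-≈ᵣ w f g f≈g)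

  ↦-reflects-≈ᵣ : ∀ {f f′ g g′ w} → f ↦[ w ] f′ → g ↦[ w ] g′ → f′ ≈ᵣ g′ → f ≈ᵣ g
  ↦-reflects-≈ᵣ {f} {_} {g} {_} {w} (image f↦) (image g↦) f′≈g′ =
    τ-≈ᵣ⁻¹ w f g (≈ᵣ-resp-≅ (≅-sym f↦) (≅-sym g↦) f′≈g′)

module Points {c ℓ : Level} (K : Field c ℓ) (q′ r : ℕ) where
  open Substitution K q′

  Φ : Pt K → Pt K
  Φ = φ K q r

  ↦-x : ∀ x → x ↦[ 2 ℕ.* r ] τ (2 ℕ.* r) x
  ↦-x _ = ↦-refl

  ↦-y : ∀ y → y ↦[ 3 ℕ.* r ] τ (3 ℕ.* r) y
  ↦-y _ = ↦-refl

  ↦-slope : ∀ l → l ↦[ 1 ℕ.* r ] τ (1 ℕ.* r) l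
  ↦-slope _ = ↦-refl

  ↦-*ᵣ : ∀ a b {f f′ g g′} → f ↦[ a ℕ.* r ] f′ → g ↦[ b ℕ.* r ] g′ →
    f *ᵣ g ↦[ (a ℕ.+ b) ℕ.* r ] f′ *ᵣ g′
  ↦-*ᵣ a b = ↦-* (≡.sym (ℕ.*-distribʳ-+ r a b))

  ↦-sum-y : ∀ l x₁ y₁ {x₃ x₃′} → x₃ ↦[ 2 ℕ.* r ] x₃′ →
    l *ᵣ (x₁ -ᵣ x₃) -ᵣ y₁ ↦[ 3 ℕ.* r ] τ (1 ℕ.* r) l *ᵣ (τ (2 ℕ.* r) x₁ -ᵣ x₃′) -ᵣ τ (3 ℕ.* r) y₁
  ↦-sum-y l x₁ y₁ x₃↦ = ↦-sub (↦-*ᵣ 1 2 (↦-slope l) (↦-sub (↦-x x₁) x₃↦)) (↦-y y₁)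

  Φ-≈Pt : ∀ P Q → _≈Pt_ K P Q → _≈Pt_ K (Φ P) (Φ Q)
  Φ-≈Pt O        O          _              = tt
  Φ-≈Pt (pt x y) (pt x′ y′) (x≈x′ , y≈y′) =
    ↦-preserves-≈ᵣ (↦-x x) (↦-x x′) x≈x′ , ↦-preserves-≈ᵣ (↦-y y) (↦-y y′) y≈y′

  Φ-≈Pt⁻¹ : ∀ P Q → _≈Pt_ K (Φ P) (Φ Q) → _≈Pt_ K P Q
  Φ-≈Pt⁻¹ O        O          _              = tt
  Φ-≈Pt⁻¹ (pt x y) (pt x′ y′) (X≈X′ , Y≈Y′) =
    ↦-reflects-≈ᵣ (↦-x x) (↦-x x′) X≈X′ , ↦-reflects-≈ᵣ (↦-y y) (↦-y y′) Y≈Y′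

  Φ-≈Pt-↦ : ∀ R {x y x′ y′} → _≈Pt_ K R (pt x y) →
    x ↦[ 2 ℕ.* r ] x′ → y ↦[ 3 ℕ.* r ] y′ → _≈Pt_ K (Φ R) (pt x′ y′)
  Φ-≈Pt-↦ (pt xR yR) (xR≈x , yR≈y) x↦ y↦ =
    ↦-preserves-≈ᵣ (↦-x xR) x↦ xR≈x , ↦-preserves-≈ᵣ (↦-y yR) y↦ yR≈y

  Φ-OnCurve : ∀ A B k m → q ℕ.* m ≡ 6 → q ℕ.* k ≡ 6 ℕ.* r →
    ∀ P → OnCurve K (D-ABkm K A B k m) P → OnCurve K (D-AB K A B) (Φ P)
  Φ-OnCurve A B k m qm≡6 qk≡6r O        _                         = tt
  Φ-OnCurve A B k m qm≡6 qk≡6r (pt x y) (x-valid , y-valid , y²≈x³+D) =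
      τ-valid (2 ℕ.* r) x x-valid
    , τ-valid (3 ℕ.* r) y y-valid
    , ↦-preserves-≈ᵣ (↦-*ᵣ 3 3 (↦-y y) (↦-y y))
        (↦-+ (↦-*ᵣ 4 2 (↦-*ᵣ 2 2 (↦-x x) (↦-x x)) (↦-x x)) D↦) y²≈x³+D
    where
    D↦ : D-ABkm K A B k m ↦[ 6 ℕ.* r ] D-AB K A B
    D↦ = ↦-X^* k (≡.trans (ℕ.+-identityʳ (q ℕ.* k)) qk≡6r)
      (↦-+ (↦-* ≡.refl (↦-ℚ A) (↦-XR^ qm≡6)) (↦-ℚ B))

  Φ-IsSum : ∀ P Q R → IsSum K P Q R → IsSum K (Φ P) (Φ Q) (Φ R)
  Φ-IsSum O          Q          R R≈Q = Φ-≈Pt R Q R≈Q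
  Φ-IsSum (pt x₁ y₁) O          R R≈P = Φ-≈Pt R (pt x₁ y₁) R≈P
  Φ-IsSum (pt x₁ y₁) (pt x₂ y₂) R (inj₁ (x₁≉x₂ , l , l-valid , chord , R≈)) = inj₁
    ( (λ X₁≈X₂ → x₁≉x₂ (↦-reflects-≈ᵣ (↦-x x₁) (↦-x x₂) X₁≈X₂))
    , τ (1 ℕ.* r) l , τ-valid (1 ℕ.* r) l l-valid
    , ↦-preserves-≈ᵣ (↦-*ᵣ 1 2 (↦-slope l) (↦-sub (↦-x x₂) (↦-x x₁)))
                     (↦-sub (↦-y y₂) (↦-y y₁)) chord
    , Φ-≈Pt-↦ R R≈ x₃↦ (↦-sum-y l x₁ y₁ x₃↦) )
    where x₃↦ = ↦-sub (↦-sub (↦-*ᵣ 1 1 (↦-slope l) (↦-slope l)) (↦-x x₁)) (↦-x x₂)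
  Φ-IsSum (pt x₁ y₁) (pt x₂ y₂) R (inj₂ (inj₁ (x₁≈x₂ , y₁≈-y₂ , R≈O))) = inj₂ (inj₁
    ( ↦-preserves-≈ᵣ (↦-x x₁) (↦-x x₂) x₁≈x₂
    , ↦-preserves-≈ᵣ (↦-y y₁) (↦-neg (↦-y y₂)) y₁≈-y₂
    , Φ-≈Pt R O R≈O ))
  Φ-IsSum (pt x₁ y₁) (pt x₂ y₂) R
    (inj₂ (inj₂ (x₁≈x₂ , y₁≈y₂ , y₁≉0 , l , l-valid , tangent , R≈))) = inj₂ (inj₂
    ( ↦-preserves-≈ᵣ (↦-x x₁) (↦-x x₂) x₁≈x₂
    , ↦-preserves-≈ᵣ (↦-y y₁) (↦-y y₂) y₁≈y₂
    , (λ Y₁≈0 → y₁≉0 (↦-reflects-≈ᵣ (↦-y y₁) (↦-zero (3 ℕ.* r)) Y₁≈0))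
    , τ (1 ℕ.* r) l , τ-valid (1 ℕ.* r) l l-valid
    , ↦-preserves-≈ᵣ (↦-*ᵣ 1 3 (↦-slope l) (↦-*ᵣ 0 3 (↦-ℕ 2) (↦-y y₁)))
                     (↦-*ᵣ 0 4 (↦-ℕ 3) (↦-*ᵣ 2 2 (↦-x x₁) (↦-x x₁))) tangent
    , Φ-≈Pt-↦ R R≈ x₃↦ (↦-sum-y l x₁ y₁ x₃↦) ))
    where x₃↦ = ↦-sub (↦-*ᵣ 1 1 (↦-slope l) (↦-slope l)) (↦-*ᵣ 0 2 (↦-ℕ 2) (↦-x x₁))

module _ {c ℓ : Level} (K : Field c ℓ) where

  IsInjectiveHomomorphism : RatF K → RatF K → (Pt K → Pt K) → Set (c ⊔ ℓ)
  IsInjectiveHomomorphism E E′ Φ =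
      (∀ P → OnCurve K E P → OnCurve K E′ (Φ P))
    × (∀ P Q → OnCurve K E P → OnCurve K E Q → _≈Pt_ K P Q → _≈Pt_ K (Φ P) (Φ Q))
    × (∀ P Q R → OnCurve K E P → OnCurve K E Q → OnCurve K E R →
         IsSum K P Q R → IsSum K (Φ P) (Φ Q) (Φ R))
    × (∀ P Q → OnCurve K E P → OnCurve K E Q → _≈Pt_ K (Φ P) (Φ Q) → _≈Pt_ K P Q)

  φ-isInjectiveHomomorphism : ∀ A B k m q r → q ℕ.* m ≡ 6 → q ℕ.* k ≡ 6 ℕ.* r →
    IsInjectiveHomomorphism (D-ABkm K A B k m) (D-AB K A B) (φ K q r)
  φ-isInjectiveHomomorphism A B k m (suc q′) r qm≡6 qk≡6r =
      Φ-OnCurve A B k m qm≡6 qk≡6r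
    , (λ P Q _ _ → Φ-≈Pt P Q)
    , (λ P Q R _ _ _ → Φ-IsSum P Q R)
    , (λ P Q _ _ → Φ-≈Pt⁻¹ P Q)
    where open Points K q′ r

[m/d]*n≡m*[n/d] : ∀ {m n d} .{{_ : NonZero d}} → d ∣ m → d ∣ n → m / d ℕ.* n ≡ m ℕ.* (n / d)
[m/d]*n≡m*[n/d] {m} {n} {d} d∣m d∣n = begin
  m / d ℕ.* n                  ≡⟨ ≡.cong (m / d ℕ.*_) (m*[n/m]≡n d∣n) ⟨
  m / d ℕ.* (d ℕ.* (n / d))    ≡⟨ ℕ.*-assoc (m / d) d (n / d) ⟨
  m / d ℕ.* d ℕ.* (n / d)      ≡⟨ ≡.cong (ℕ._* (n / d)) (m/n*n≡m d∣m) ⟩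
  m ℕ.* (n / d)                ∎
  where open ≡.≡-Reasoning

mainTheorem4 : ∀ {c ℓ : Level} (K : Field c ℓ) → CharZero K →
    (A B : ℚ) → A ≢ 0ℚ → B ≢ 0ℚ →
    (k : ℕ) → k ≤ 5 → (m : ℕ) → .{{_ : NonZero m}} → m ∣ gcd 6 k →
    let q = 6 / m
        r = k / m
        E₁ = D-AB K A B
        E₂ = D-ABkm K A B k m
    in
    -- the map sends E_{A,B,k,m}(K(s)) into E_{A,B}(K(t))
      (∀ P → OnCurve K E₂ P → OnCurve K E₁ (φ K q r P))
    -- it is well defined on points (respects equality in K(s))
    × (∀ P Q → OnCurve K E₂ P → OnCurve K E₂ Q →
         _≈Pt_ K P Q → _≈Pt_ K (φ K q r P) (φ K q r Q))
    -- it is a group homomorphism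
    × (∀ P Q R → OnCurve K E₂ P → OnCurve K E₂ Q → OnCurve K E₂ R →
         IsSum K P Q R → IsSum K (φ K q r P) (φ K q r Q) (φ K q r R))
    -- it is injective
    × (∀ P Q → OnCurve K E₂ P → OnCurve K E₂ Q →
         _≈Pt_ K (φ K q r P) (φ K q r Q) → _≈Pt_ K P Q)
mainTheorem4 K _ A B _ _ k _ m m∣gcd =
  φ-isInjectiveHomomorphism K A B k m (6 / m) (k / m) (m/n*n≡m m∣6) ([m/d]*n≡m*[n/d] m∣6 m∣k)
  where
  m∣6 = ∣-trans m∣gcd (gcd[m,n]∣m 6 k)
  m∣k = ∣-trans m∣gcd (gcd[m,n]∣n 6 k)
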